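{- In any implicative structure $\mathscr{A}$, $\mathbf{p}\text{ - }\mathbf{or}^{\mathscr{A}}\dashv\vdash_{S^0_K(\mathscr{A})}{\pitchfork}^{\mathscr{A}}$, i.e. both $(\mathbf{p}\text{ - }\mathbf{or}^{\mathscr{A}}\to{\pitchfork}^{\mathscr{A}})$ and $({\pitchfork}^{\mathscr{A}}\to\mathbf{p}\text{ - }\mathbf{or}^{\mathscr{A}})$ belong to the classical core $S^0_K(\mathscr{A})$.
   Context: An implicative structure is a complete lattice $(\mathscr{A},\preccurlyeq)$ (meets $\bigwedge$, binary meet $\wedge$, top $\top$, bottom $\bot$) with $\to$ anti-monotonic in its first and monotonic in its second argument, commuting with arbitrary meets in its second argument. A separator is an upwards closed subset containing $\bigwedge_{a,b}(a\to b\to a)$ and $\bigwedge_{a,b,c}((a\to b\to c)\to(a\to b)\to a\to c)$ and closed under modus ponens. The classical core $S^0_K(\mathscr{A})$ is the smallest separator containing $\mathtt{cc}^{\mathscr{A}}=\bigwedge_{a,b}(((a\to b)\to a)\to a)$. ${\pitchfork}^{\mathscr{A}}=\bigwedge_{a,b}(a\to b\to a\wedge b)$ and $\mathbf{p}\text{ - }\mathbf{or}^{\mathscr{A}}=(\bot\to\top\to\bot)\wedge(\top\to\bot\to\bot)$. -}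

module Defs where

open import Level using (Level; suc; _⊔_)
open import Data.Product using (_×_)
open import Relation.Binary.PropositionalEquality using (_≡_)

record ImplicativeStructure (ℓ : Level) : Set (suc ℓ) where
  infixr 5 _⇒_
  infix  4 _≼_
  field
    Carrier : Set ℓ
    _≼_     : Carrier → Carrier → Set ℓ
    ≼-refl  : ∀ {a} → a ≼ a
    ≼-trans : ∀ {a b c} → a ≼ b → b ≼ c → a ≼ c
    ≼-antisym : ∀ {a b} → a ≼ b → b ≼ a → a ≡ b
    ⋀       : {I : Set ℓ} → (I → Carrier) → Carrier
    ⋀-lb    : {I : Set ℓ} (f : I → Carrier) (i : I) → ⋀ f ≼ f i
    ⋀-glb   : {I : Set ℓ} (f : I → Carrier) (c : Carrier) →
              (∀ i → c ≼ f i) → c ≼ ⋀ f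
    _⇒_     : Carrier → Carrier → Carrier
    ⇒-mono  : ∀ {a a' b b'} → a' ≼ a → b ≼ b' → (a ⇒ b) ≼ (a' ⇒ b')
    ⇒-⋀     : ∀ (a : Carrier) {I : Set ℓ} (f : I → Carrier) →
              (a ⇒ ⋀ f) ≡ ⋀ (λ i → a ⇒ f i)

module _ {ℓ : Level} (𝒜 : ImplicativeStructure ℓ) where
  open ImplicativeStructure 𝒜

  data Two : Set ℓ where
    one two : Two

  pair : Carrier → Carrier → Two → Carrier
  pair a b one = a
  pair a b two = b

  _∧_ : Carrier → Carrier → Carrier
  a ∧ b = ⋀ {I = Two} (pair a b)

  data Empty : Set ℓ where

  ⊤ᴬ : Carrier
  ⊤ᴬ = ⋀ {I = Empty} empty-elim
    where
    empty-elim : Empty → Carrier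
    empty-elim ()

  ⊥ᴬ : Carrier
  ⊥ᴬ = ⋀ {I = Carrier} (λ a → a)

  ⋀₂ : (Carrier → Carrier → Carrier) → Carrier
  ⋀₂ f = ⋀ {I = Carrier} (λ a → ⋀ {I = Carrier} (λ b → f a b))

  ⋀₃ : (Carrier → Carrier → Carrier → Carrier) → Carrier
  ⋀₃ f = ⋀ {I = Carrier} (λ a → ⋀₂ (f a))

  𝐤 : Carrier
  𝐤 = ⋀₂ (λ a b → a ⇒ b ⇒ a)

  𝐬 : Carrier
  𝐬 = ⋀₃ (λ a b c → (a ⇒ b ⇒ c) ⇒ (a ⇒ b) ⇒ a ⇒ c)

  cc : Carrier
  cc = ⋀₂ (λ a b → ((a ⇒ b) ⇒ a) ⇒ a)

  pitchfork : Carrier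
  pitchfork = ⋀₂ (λ a b → a ⇒ b ⇒ (a ∧ b))

  p-or : Carrier
  p-or = (⊥ᴬ ⇒ ⊤ᴬ ⇒ ⊥ᴬ) ∧ (⊤ᴬ ⇒ ⊥ᴬ ⇒ ⊥ᴬ)

  record IsSeparator (S : Carrier → Set ℓ) : Set ℓ where
    field
      upward : ∀ {a b} → a ≼ b → S a → S b
      has-k  : S 𝐤
      has-s  : S 𝐬
      mp     : ∀ {a b} → S (a ⇒ b) → S a → S b

  -- the classical core S⁰_K: the smallest separator containing cc,
  -- i.e. the intersection of all separators containing cc
  ClassicalCore : Carrier → Set (suc ℓ)
  ClassicalCore x = (S : Carrier → Set ℓ) → IsSeparator S → S cc → S x

module Submission where

-- Write x ∙ y = ⋀ {c | x ≼ y ⇒ c} for application in an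
-- implicative structure; it is left adjoint to implication
-- (x ∙ y ≼ c ⇔ x ≼ y ⇒ c), so 𝐤 and 𝐬 satisfy their combinatory
-- reductions up to ≼, and cc satisfies Peirce's rule.  Every separator is
-- closed under ∙, hence contains the value of every closed combinatory term
-- built from K, S and C (for cc); by bracket abstraction such terms can be
-- written as λ-terms.  Consequently a value x is in the classical core as
-- soon as some closed term evaluates below x.
--
-- The two entailments are then witnessed by explicit terms:
--   * λp a b. cc (λk. p (k a) (k b))  lies below  p-or ⇒ ⋔ : with
--     k : a ⇒ ⊥ the first conjunct ⊥ ⇒ ⊤ ⇒ ⊥ of p-or makes p (k a) (k b)
--     land in ⊥, so cc yields a; symmetrically the second conjunct yields b;
--   * λx. x  lies below  ⋔ ⇒ p-or, because ⋔ ≼ p-or already holds.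

open import Defs
open import Level using (Level)
open import Data.Nat using (ℕ)
open import Data.Fin using (Fin; zero; suc)
open import Data.Product using (_×_; _,_; Σ; proj₁; proj₂)
open import Relation.Binary.PropositionalEquality using (subst; sym)

data Term (n : ℕ) : Set where
  var   : Fin n → Term n
  K S C : Term n
  _·_   : Term n → Term n → Term n

infixl 7 _·_
infixr 6 ƛ_

ƛ_ : ∀ {n} → Term (ℕ.suc n) → Term n
ƛ var zero    = S · K · K
ƛ var (suc i) = K · var i
ƛ K           = K · K
ƛ S           = K · S
ƛ C           = K · C
ƛ (t · u)     = S · (ƛ t) · (ƛ u)

module Realizability {ℓ : Level} (𝒜 : ImplicativeStructure ℓ) where
  open ImplicativeStructure 𝒜

  ⊥ : Carrier
  ⊥ = ⊥ᴬ 𝒜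

  ⊤ : Carrier
  ⊤ = ⊤ᴬ 𝒜

  infixl 7 _∙_
  infixr 6 _⊓_

  _⊓_ : Carrier → Carrier → Carrier
  _⊓_ = _∧_ 𝒜

  _∙_ : Carrier → Carrier → Carrier
  x ∙ y = ⋀ {I = Σ Carrier (λ c → x ≼ y ⇒ c)} proj₁

  uncurry≼ : ∀ {x y c} → x ≼ y ⇒ c → x ∙ y ≼ c
  uncurry≼ {c = c} h = ⋀-lb _ (c , h)

  curry≼ : ∀ {x y c} → x ∙ y ≼ c → x ≼ y ⇒ c
  curry≼ {x} {y} h = ≼-trans unit (⇒-mono ≼-refl h)
    where
    -- the unit of the adjunction, using that ⇒ commutes with meets
    unit : x ≼ y ⇒ (x ∙ y)
    unit = subst (x ≼_) (sym (⇒-⋀ y proj₁)) (⋀-glb _ x proj₂)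

  apply≼ : ∀ {x y a b} → x ≼ a ⇒ b → y ≼ a → x ∙ y ≼ b
  apply≼ hx hy = uncurry≼ (≼-trans hx (⇒-mono hy ≼-refl))

  ∙-mono : ∀ {x x' y y'} → x ≼ x' → y ≼ y' → x ∙ y ≼ x' ∙ y'
  ∙-mono hx hy = ⋀-glb _ _ (λ { (c , h) → apply≼ (≼-trans hx h) hy })

  𝐤-β : ∀ {x y} → 𝐤 𝒜 ∙ x ∙ y ≼ x
  𝐤-β {x} {y} = apply≼ (apply≼ (≼-trans (⋀-lb _ x) (⋀-lb _ y)) ≼-refl) ≼-refl

  𝐬-β : ∀ {x y z} → 𝐬 𝒜 ∙ x ∙ y ∙ z ≼ x ∙ z ∙ (y ∙ z)
  𝐬-β {x} {y} {z} = apply≼ (apply≼ (apply≼ 𝐬-inst (curry≼ (curry≼ ≼-refl)))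
                                     (curry≼ ≼-refl)) ≼-refl
    where
    𝐬-inst : 𝐬 𝒜 ≼ (z ⇒ y ∙ z ⇒ x ∙ z ∙ (y ∙ z)) ⇒ (z ⇒ y ∙ z) ⇒ z ⇒ x ∙ z ∙ (y ∙ z)
    𝐬-inst = ≼-trans (⋀-lb _ z) (≼-trans (⋀-lb _ (y ∙ z)) (⋀-lb _ (x ∙ z ∙ (y ∙ z))))

  cc-β : ∀ {x a b} → x ≼ (a ⇒ b) ⇒ a → cc 𝒜 ∙ x ≼ a
  cc-β {a = a} {b} h = apply≼ (≼-trans (⋀-lb _ a) (⋀-lb _ b)) h

  ⊤-max : ∀ {c} → c ≼ ⊤
  ⊤-max = ⋀-glb _ _ (λ ())

  ⊥-min : ∀ {c} → ⊥ ≼ c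
  ⊥-min {c} = ⋀-lb _ c

  ⊓-π₁ : ∀ {a b} → a ⊓ b ≼ a
  ⊓-π₁ = ⋀-lb _ one

  ⊓-π₂ : ∀ {a b} → a ⊓ b ≼ b
  ⊓-π₂ = ⋀-lb _ two

  ⊓-intro : ∀ {c a b} → c ≼ a → c ≼ b → c ≼ a ⊓ b
  ⊓-intro ha hb = ⋀-glb _ _ (λ { one → ha ; two → hb })

  cc-¬¬ : ∀ {x a} → x ≼ (a ⇒ ⊥) ⇒ ⊥ → cc 𝒜 ∙ x ≼ a
  cc-¬¬ h = cc-β (≼-trans h (⇒-mono ≼-refl ⊥-min))

  Env : ℕ → Set ℓ
  Env n = Fin n → Carrier

  ∅ : Env 0
  ∅ ()

  extend : ∀ {n} → Env n → Carrier → Env (ℕ.suc n)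
  extend ρ a zero    = a
  extend ρ a (suc i) = ρ i

  ⟦_⟧_ : ∀ {n} → Term n → Env n → Carrier
  ⟦ var i ⟧ ρ = ρ i
  ⟦ K ⟧ ρ     = 𝐤 𝒜
  ⟦ S ⟧ ρ     = 𝐬 𝒜
  ⟦ C ⟧ ρ     = cc 𝒜
  ⟦ t · u ⟧ ρ = ⟦ t ⟧ ρ ∙ ⟦ u ⟧ ρ

  ƛ-β : ∀ {n} (t : Term (ℕ.suc n)) (ρ : Env n) (a : Carrier) →
        ⟦ ƛ t ⟧ ρ ∙ a ≼ ⟦ t ⟧ extend ρ a
  ƛ-β (var zero)    ρ a = ≼-trans 𝐬-β 𝐤-β
  ƛ-β (var (suc i)) ρ a = 𝐤-β
  ƛ-β K             ρ a = 𝐤-β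
  ƛ-β S             ρ a = 𝐤-β
  ƛ-β C             ρ a = 𝐤-β
  ƛ-β (t · u)       ρ a = ≼-trans 𝐬-β (∙-mono (ƛ-β t ρ a) (ƛ-β u ρ a))

  module _ {Sep : Carrier → Set ℓ} (sep : IsSeparator 𝒜 Sep) (sep-cc : Sep (cc 𝒜)) where
    open IsSeparator sep

    ∙-closed : ∀ {x y} → Sep x → Sep y → Sep (x ∙ y)
    ∙-closed sx sy = mp (upward (curry≼ ≼-refl) sx) sy

    ⟦⟧-closed : ∀ {n} (t : Term n) {ρ : Env n} → (∀ i → Sep (ρ i)) → Sep (⟦ t ⟧ ρ)
    ⟦⟧-closed (var i) hρ = hρ i
    ⟦⟧-closed K       hρ = has-k
    ⟦⟧-closed S       hρ = has-s
    ⟦⟧-closed C       hρ = sep-cc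
    ⟦⟧-closed (t · u) hρ = ∙-closed (⟦⟧-closed t hρ) (⟦⟧-closed u hρ)

  realized⇒core : ∀ {x} (t : Term 0) → ⟦ t ⟧ ∅ ≼ x → ClassicalCore 𝒜 x
  realized⇒core t h Sep sep sep-cc =
    IsSeparator.upward sep h (⟦⟧-closed sep sep-cc t (λ ()))

  -- The realizer of p-or ⇒ ⋔:  λp a b. cc (λk. p (k a) (k b));
  -- refute is its innermost body p (k a) (k b).
  refute : Term 4
  refute = p · (k · a) · (k · b)
    where
    p a b k : Term 4
    p = var (suc (suc (suc zero)))
    a = var (suc (suc zero))
    b = var (suc zero)
    k = var zero

  pair-by-cc : Term 0
  pair-by-cc = ƛ ƛ ƛ C · (ƛ refute)

  pair-by-cc-β : ∀ p a b →
    ⟦ pair-by-cc ⟧ ∅ ∙ p ∙ a ∙ b ≼ cc 𝒜 ∙ ⟦ ƛ refute ⟧ extend (extend (extend ∅ p) a) b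
  pair-by-cc-β p a b =
    ≼-trans (∙-mono (∙-mono (ƛ-β (ƛ ƛ C · (ƛ refute)) ∅ p) ≼-refl) ≼-refl)
      (≼-trans (∙-mono (ƛ-β (ƛ C · (ƛ refute)) (extend ∅ p) a) ≼-refl)
               (ƛ-β (C · (ƛ refute)) (extend (extend ∅ p) a) b))

  pair-by-cc-select : ∀ {p a b c u v} → p ≼ u ⇒ v ⇒ ⊥ →
    (c ⇒ ⊥) ∙ a ≼ u → (c ⇒ ⊥) ∙ b ≼ v → ⟦ pair-by-cc ⟧ ∅ ∙ p ∙ a ∙ b ≼ c
  pair-by-cc-select {p} {a} {b} {c} hp ha hb =
    ≼-trans (pair-by-cc-β p a b)
      (cc-¬¬ (curry≼ (≼-trans (ƛ-β refute (extend (extend (extend ∅ p) a) b) (c ⇒ ⊥))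
                               (apply≼ (apply≼ hp ha) hb))))

  pair-by-cc-realizes : ⟦ pair-by-cc ⟧ ∅ ≼ p-or 𝒜 ⇒ pitchfork 𝒜
  pair-by-cc-realizes = curry≼ (⋀-glb _ _ λ a → ⋀-glb _ _ λ b → curry≼ (curry≼ (⊓-intro
    (pair-by-cc-select ⊓-π₁ (apply≼ ≼-refl ≼-refl) ⊤-max)
    (pair-by-cc-select ⊓-π₂ ⊤-max (apply≼ ≼-refl ≼-refl)))))

  pitchfork-inst : ∀ {a b} → pitchfork 𝒜 ≼ a ⇒ b ⇒ a ⊓ b
  pitchfork-inst {a} {b} = ≼-trans (⋀-lb _ a) (⋀-lb _ b)

  pitchfork≼p-or : pitchfork 𝒜 ≼ p-or 𝒜
  pitchfork≼p-or = ⊓-intro (≼-trans pitchfork-inst (⇒-mono ≼-refl (⇒-mono ≼-refl ⊓-π₁)))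
                           (≼-trans pitchfork-inst (⇒-mono ≼-refl (⇒-mono ≼-refl ⊓-π₂)))

  identity-realizes : ∀ {a b} → a ≼ b → ⟦ ƛ var zero ⟧ ∅ ≼ a ⇒ b
  identity-realizes {a} h = curry≼ (≼-trans (ƛ-β (var zero) ∅ a) h)

proposition3p29 : {ℓ : Level} (𝒜 : ImplicativeStructure ℓ) →
    let open ImplicativeStructure 𝒜 in
    ClassicalCore 𝒜 (p-or 𝒜 ⇒ pitchfork 𝒜) × ClassicalCore 𝒜 (pitchfork 𝒜 ⇒ p-or 𝒜)
proposition3p29 𝒜 =
  realized⇒core pair-by-cc pair-by-cc-realizes ,
  realized⇒core (ƛ var zero) (identity-realizes pitchfork≼p-or)
  where open Realizability 𝒜
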